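{- Let $n\ge0$ and let $T$ be the prefix of $M_{n+1}$ of length $t<q_{n+1}$. Write $t=d_1+d_2q_1+\cdots+d_{n+1}q_n$, where $d_1,\dots,d_{n+1}$ are the digits of $t$ in the Ostrowski numeration system in base $\theta$. Then $$T=M_n^{d_{n+1}}M_{n-1}^{d_n}\cdots M_0^{d_1}=V_0^{d_1}V_1^{d_2}\cdots V_n^{d_{n+1}},$$ where the words $V_0,\dots,V_n$ are defined by $V_{ -1}=1$, $V_0=0$, $V_1=0^{a_1-d_1-1}10^{d_1}$, and $V_{k+1}=V_k^{a_{k+1}-d_{k+1}}V_{k-1}V_k^{d_{k+1}}$ for $1\le k<n$.
   Context: Let $\theta=[0;a_1,a_2,\dots]\in(0,1)$ be irrational with $q_{ -1}=0$, $q_0=1$, $q_k=a_kq_{k-1}+q_{k-2}$. Words over $\{0,1\}$: $M_0=0$, $M_1=0^{a_1-1}1$, $M_k=M_{k-1}^{a_k}M_{k-2}$ ($k\ge2$), $|M_k|=q_k$. Ostrowski numeration: every integer $0\le t<q_{n+1}$ can be uniquely written $t=\sum_{j=1}^{n+1}d_jq_{j-1}$ with $0\le d_1\le a_1-1$, $0\le d_j\le a_j$ for $j\ge2$, and $d_j=0$ whenever $d_{j+1}=a_{j+1}$. -}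

module Defs where

open import Data.Nat using (ℕ; zero; suc; _+_; _*_; _∸_; _≤_; _<_)
open import Data.Bool using (Bool; true; false)
open import Data.List using (List; []; _∷_; _++_; concat; replicate)
open import Relation.Binary.PropositionalEquality using (_≡_)

-- Words over {0,1}: the letter 0 is 'false', the letter 1 is 'true'.
Word : Set
Word = List Bool

_^ʷ_ : Word → ℕ → Word
w ^ʷ m = concat (replicate m w)

-- The continued-fraction partial quotients a_1, a_2, ... are given by a
-- sequence a : ℕ → ℕ (a 0 is unused); a_k ≥ 1 for k ≥ 1.
PartialQuotients : (ℕ → ℕ) → Set
PartialQuotients a = ∀ k → 1 ≤ a (suc k)

-- q k = q_k for k ≥ 0  (q_{-1} = 0, q_0 = 1, q_k = a_k q_{k-1} + q_{k-2})
q : (ℕ → ℕ) → ℕ → ℕ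
q a zero = 1
q a (suc zero) = a 1
q a (suc (suc k)) = a (suc (suc k)) * q a (suc k) + q a k

M : (ℕ → ℕ) → ℕ → Word
M a zero = false ∷ []
M a (suc zero) = replicate (a 1 ∸ 1) false ++ (true ∷ [])
M a (suc (suc k)) = (M a (suc k) ^ʷ a (suc (suc k))) ++ M a k

-- Ostrowski digits d_1,...,d_{n+1} are given by d : ℕ → ℕ (only the
-- indices 1..n+1 matter).
-- ostSum a d n = d_1 q_0 + d_2 q_1 + ... + d_{n+1} q_n
ostSum : (ℕ → ℕ) → (ℕ → ℕ) → ℕ → ℕ
ostSum a d zero = d 1 * q a 0
ostSum a d (suc k) = ostSum a d k + d (suc (suc k)) * q a (suc k)

record OstrowskiDigits (a : ℕ → ℕ) (n : ℕ) (d : ℕ → ℕ) (t : ℕ) : Set where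
  field
    digit₁   : d 1 ≤ a 1 ∸ 1
    digitⱼ   : ∀ j → 2 ≤ j → j ≤ suc n → d j ≤ a j
    maxCond  : ∀ j → 1 ≤ j → j ≤ n → d (suc j) ≡ a (suc j) → d j ≡ 0
    value    : ostSum a d n ≡ t

prodM : (ℕ → ℕ) → (ℕ → ℕ) → ℕ → Word
prodM a d zero = M a 0 ^ʷ d 1
prodM a d (suc k) = (M a (suc k) ^ʷ d (suc (suc k))) ++ prodM a d k

-- V k = V_k (depends on the digits d); V_{-1} = 1 is never needed
-- for k ≥ 0 in the recursion below.
V : (ℕ → ℕ) → (ℕ → ℕ) → ℕ → Word
V a d zero = false ∷ []
V a d (suc zero) = replicate (a 1 ∸ d 1 ∸ 1) false ++ (true ∷ replicate (d 1) false)
V a d (suc (suc k)) =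
  (V a d (suc k) ^ʷ (a (suc (suc k)) ∸ d (suc (suc k))))
  ++ V a d k ++ (V a d (suc k) ^ʷ d (suc (suc k)))

prodV : (ℕ → ℕ) → (ℕ → ℕ) → ℕ → Word
prodV a d zero = V a d 0 ^ʷ d 1
prodV a d (suc k) = prodV a d k ++ (V a d (suc k) ^ʷ d (suc (suc k)))

-- Write M_{n+1} = M_n^{d_{n+1}} · M_n^{a_{n+1}-d_{n+1}} M_{n-1}. The digit conditions
-- give t' := t - d_{n+1} q_n < q_n, and even t' < q_{n-1} when d_{n+1} = a_{n+1}
-- (then d_n = 0), so the rest of the prefix lies inside M_n, resp. M_{n-1}, and
-- induction yields T = M_n^{d_{n+1}} ⋯ M_0^{d_1}.
-- For the second factorisation, P_k := M_k^{d_{k+1}} ⋯ M_0^{d_1} satisfies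
-- M_k P_k = P_k V_k and M_{k+1} P_k = P_k V_{k+1} (simultaneous induction: V_{k+1}
-- is built from V_k, V_{k-1} as M_{k+1} is from M_k, M_{k-1}, rotated by
-- M_k^{d_{k+1}}). Hence P_k = M_k^{d_{k+1}} P_{k-1} = P_{k-1} V_k^{d_{k+1}}, and
-- induction gives P_n = V_0^{d_1} ⋯ V_n^{d_{n+1}}.
module Submission where

open import Defs
open import Data.Nat using (ℕ; zero; suc; _+_; _*_; _∸_; _≤_; _<_; z≤n; s≤s)
open import Data.Nat.Properties
open import Data.Bool using (true; false)
open import Data.List using (List; []; _∷_; _++_; take; length; replicate)
open import Data.List.Properties using (++-assoc; ++-identityʳ; length-++; length-replicate)
open import Data.Product using (_×_; _,_)
open import Data.Sum using (_⊎_; inj₁; inj₂)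
open import Relation.Binary.PropositionalEquality
open import Function using (_$_)

take-++ˡ : ∀ {A : Set} (xs ys : List A) {t} → t ≤ length xs → take t (xs ++ ys) ≡ take t xs
take-++ˡ xs       ys {zero}  _       = refl
take-++ˡ (x ∷ xs) ys {suc t} (s≤s p) = cong (x ∷_) (take-++ˡ xs ys p)

take-length-++ : ∀ {A : Set} (xs ys : List A) t → take (length xs + t) (xs ++ ys) ≡ xs ++ take t ys
take-length-++ []       ys t = refl
take-length-++ (x ∷ xs) ys t = cong (x ∷_) (take-length-++ xs ys t)

take-replicate : ∀ {A : Set} (x : A) {t m} → t ≤ m → take t (replicate m x) ≡ replicate t x
take-replicate x {zero}  _       = refl
take-replicate x {suc t} (s≤s p) = cong (x ∷_) (take-replicate x p)

[x]^ʷ≡replicate : ∀ x n → (x ∷ []) ^ʷ n ≡ replicate n x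
[x]^ʷ≡replicate x zero    = refl
[x]^ʷ≡replicate x (suc n) = cong (x ∷_) ([x]^ʷ≡replicate x n)

^ʷ-+ : ∀ w m n → w ^ʷ (m + n) ≡ (w ^ʷ m) ++ (w ^ʷ n)
^ʷ-+ w zero    n = refl
^ʷ-+ w (suc m) n = trans (cong (w ++_) (^ʷ-+ w m n)) (sym (++-assoc w (w ^ʷ m) (w ^ʷ n)))

^ʷ-split : ∀ w {e m} → e ≤ m → w ^ʷ m ≡ (w ^ʷ e) ++ (w ^ʷ (m ∸ e))
^ʷ-split w {e} {m} e≤m = trans (cong (w ^ʷ_) (sym (m+[n∸m]≡n e≤m))) (^ʷ-+ w e (m ∸ e))

length-^ʷ : ∀ w n → length (w ^ʷ n) ≡ n * length w
length-^ʷ w zero    = refl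
length-^ʷ w (suc n) = trans (length-++ w) (cong (length w +_) (length-^ʷ w n))

take-^ʷ-++ : ∀ w ys k s → take (s + k * length w) ((w ^ʷ k) ++ ys) ≡ (w ^ʷ k) ++ take s ys
take-^ʷ-++ w ys k s = begin
  take (s + k * length w) ((w ^ʷ k) ++ ys)        ≡⟨ cong (λ m → take m ((w ^ʷ k) ++ ys)) s+k|w|≡|wᵏ|+s ⟩
  take (length (w ^ʷ k) + s) ((w ^ʷ k) ++ ys)     ≡⟨ take-length-++ (w ^ʷ k) ys s ⟩
  (w ^ʷ k) ++ take s ys                           ∎
  where
  open ≡-Reasoning
  s+k|w|≡|wᵏ|+s : s + k * length w ≡ length (w ^ʷ k) + s
  s+k|w|≡|wᵏ|+s = trans (+-comm s _) (cong (_+ s) (sym (length-^ʷ w k)))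

record Conjugate (p u v : Word) : Set where
  constructor conjugate
  field commute : u ++ p ≡ p ++ v
open Conjugate

conj-rotate : ∀ {x y u v} → x ++ y ≡ u → y ++ x ≡ v → Conjugate x u v
conj-rotate {x} {y} refl refl = conjugate (++-assoc x y x)

conj-trans : ∀ {p r u v w} → Conjugate p u v → Conjugate r v w → Conjugate (p ++ r) u w
conj-trans {p} {r} {u} {v} {w} (conjugate puv) (conjugate rvw) = conjugate $ begin
  u ++ (p ++ r)   ≡⟨ sym (++-assoc u p r) ⟩
  (u ++ p) ++ r   ≡⟨ cong (_++ r) puv ⟩
  (p ++ v) ++ r   ≡⟨ ++-assoc p v r ⟩
  p ++ (v ++ r)   ≡⟨ cong (p ++_) rvw ⟩
  p ++ (r ++ w)   ≡⟨ sym (++-assoc p r w) ⟩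
  (p ++ r) ++ w   ∎
  where open ≡-Reasoning

conj-++ : ∀ {p u v u′ v′} → Conjugate p u v → Conjugate p u′ v′ → Conjugate p (u ++ u′) (v ++ v′)
conj-++ {p} {u} {v} {u′} {v′} (conjugate puv) (conjugate pu′v′) = conjugate $ begin
  (u ++ u′) ++ p   ≡⟨ ++-assoc u u′ p ⟩
  u ++ (u′ ++ p)   ≡⟨ cong (u ++_) pu′v′ ⟩
  u ++ (p ++ v′)   ≡⟨ sym (++-assoc u p v′) ⟩
  (u ++ p) ++ v′   ≡⟨ cong (_++ v′) puv ⟩
  (p ++ v) ++ v′   ≡⟨ ++-assoc p v v′ ⟩
  p ++ (v ++ v′)   ∎
  where open ≡-Reasoning

conj-^ʷ : ∀ {p u v} → Conjugate p u v → ∀ k → Conjugate p (u ^ʷ k) (v ^ʷ k)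
conj-^ʷ {p} puv zero    = conjugate (sym (++-identityʳ p))
conj-^ʷ {p} puv (suc k) = conj-++ puv (conj-^ʷ puv k)

conj-^ʷ-self : ∀ u k → Conjugate (u ^ʷ k) u u
conj-^ʷ-self u zero    = conjugate (++-identityʳ u)
conj-^ʷ-self u (suc k) = conj-trans (conjugate refl) (conj-^ʷ-self u k)

length-M : ∀ {a} → PartialQuotients a → ∀ k → length (M a k) ≡ q a k
length-M pq zero              = refl
length-M {a} pq (suc zero)    =
  trans (length-++ (replicate (a 1 ∸ 1) false))
        (trans (cong (_+ 1) (length-replicate (a 1 ∸ 1))) (m∸n+n≡m (pq 0)))
length-M {a} pq (suc (suc k)) =
  trans (length-++ (M a (suc k) ^ʷ a (suc (suc k))))
        (cong₂ _+_ (trans (length-^ʷ (M a (suc k)) (a (suc (suc k))))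
                          (cong (a (suc (suc k)) *_) (length-M pq (suc k))))
                   (length-M pq k))

module _ {a d : ℕ → ℕ} where

  restrict : ∀ {n t} → OstrowskiDigits a (suc n) d t → OstrowskiDigits a n d (ostSum a d n)
  restrict od = record
    { digit₁  = digit₁
    ; digitⱼ  = λ j 2≤j j≤n → digitⱼ j 2≤j (m≤n⇒m≤1+n j≤n)
    ; maxCond = λ j 1≤j j≤n → maxCond j 1≤j (m≤n⇒m≤1+n j≤n)
    ; value   = refl
    }
    where open OstrowskiDigits od

  module _ {n t} (od : OstrowskiDigits a (suc n) d t) where
    open OstrowskiDigits od

    leadingDigit≤ : d (suc (suc n)) ≤ a (suc (suc n))
    leadingDigit≤ = digitⱼ (suc (suc n)) (s≤s (s≤s z≤n)) ≤-refl

    leadingDigit≡max⇒nextDigit≡0 : d (suc (suc n)) ≡ a (suc (suc n)) → d (suc n) ≡ 0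
    leadingDigit≡max⇒nextDigit≡0 = maxCond (suc n) (s≤s z≤n) ≤-refl

  mutual
    prodM-conj-V : ∀ {k t} → OstrowskiDigits a k d t → Conjugate (prodM a d k) (M a k) (V a d k)
    prodM-conj-V {zero}  od = conj-^ʷ-self (false ∷ []) (d 1)
    prodM-conj-V {suc k} od =
      conj-trans (conj-^ʷ-self (M a (suc k)) (d (suc (suc k)))) (prodM-conj-Vsuc (restrict od))

    prodM-conj-Vsuc : ∀ {k t} → OstrowskiDigits a k d t → Conjugate (prodM a d k) (M a (suc k)) (V a d (suc k))
    prodM-conj-Vsuc {zero} od = conj-rotate 0ᵈ¹++tail≡M₁
      (trans (++-assoc (replicate r false) (true ∷ []) _)
             (cong (λ w → replicate r false ++ (true ∷ w)) ([x]^ʷ≡replicate false (d 1))))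
      where
      open OstrowskiDigits od
      r = a 1 ∸ d 1 ∸ 1
      0ᵈ¹++tail≡M₁ : ((false ∷ []) ^ʷ d 1) ++ (replicate r false ++ (true ∷ [])) ≡ M a 1
      0ᵈ¹++tail≡M₁ = begin
        ((false ∷ []) ^ʷ d 1) ++ (replicate r false ++ (true ∷ []))
          ≡⟨ sym (++-assoc ((false ∷ []) ^ʷ d 1) _ _) ⟩
        (((false ∷ []) ^ʷ d 1) ++ replicate r false) ++ (true ∷ [])
          ≡⟨ cong (λ w → (((false ∷ []) ^ʷ d 1) ++ w) ++ (true ∷ [])) (sym ([x]^ʷ≡replicate false r)) ⟩
        (((false ∷ []) ^ʷ d 1) ++ ((false ∷ []) ^ʷ r)) ++ (true ∷ [])
          ≡⟨ cong (_++ (true ∷ [])) (sym (^ʷ-+ (false ∷ []) (d 1) r)) ⟩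
        ((false ∷ []) ^ʷ (d 1 + r)) ++ (true ∷ [])
          ≡⟨ cong (λ m → ((false ∷ []) ^ʷ m) ++ (true ∷ [])) d₁+r≡a₁∸1 ⟩
        ((false ∷ []) ^ʷ (a 1 ∸ 1)) ++ (true ∷ [])
          ≡⟨ cong (_++ (true ∷ [])) ([x]^ʷ≡replicate false (a 1 ∸ 1)) ⟩
        M a 1 ∎
        where
        open ≡-Reasoning
        d₁+r≡a₁∸1 : d 1 + r ≡ a 1 ∸ 1
        d₁+r≡a₁∸1 = begin
          d 1 + (a 1 ∸ d 1 ∸ 1)   ≡⟨ cong (d 1 +_) (∸-+-assoc (a 1) (d 1) 1) ⟩
          d 1 + (a 1 ∸ (d 1 + 1)) ≡⟨ cong (λ m → d 1 + (a 1 ∸ m)) (+-comm (d 1) 1) ⟩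
          d 1 + (a 1 ∸ (1 + d 1)) ≡⟨ cong (d 1 +_) (sym (∸-+-assoc (a 1) 1 (d 1))) ⟩
          d 1 + (a 1 ∸ 1 ∸ d 1)   ≡⟨ m+[n∸m]≡n digit₁ ⟩
          a 1 ∸ 1                 ∎
    prodM-conj-Vsuc {suc k} od = conj-trans outer inner
      where
      e = d (suc (suc k))
      A = a (suc (suc k))
      M₁ = M a (suc k)
      V₁ = V a d (suc k)
      inner : Conjugate (prodM a d k) ((M₁ ^ʷ (A ∸ e)) ++ M a k ++ (M₁ ^ʷ e)) ((V₁ ^ʷ (A ∸ e)) ++ V a d k ++ (V₁ ^ʷ e))
      inner = conj-++ (conj-^ʷ Vsuc (A ∸ e)) (conj-++ (prodM-conj-V (restrict od)) (conj-^ʷ Vsuc e))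
        where Vsuc = prodM-conj-Vsuc (restrict od)
      outer : Conjugate (M₁ ^ʷ e) (M a (suc (suc k))) ((M₁ ^ʷ (A ∸ e)) ++ M a k ++ (M₁ ^ʷ e))
      outer = conj-rotate
        (trans (sym (++-assoc (M₁ ^ʷ e) _ (M a k))) (cong (_++ M a k) (sym (^ʷ-split M₁ (leadingDigit≤ od)))))
        (++-assoc (M₁ ^ʷ (A ∸ e)) (M a k) _)

  prodV≡prodM : ∀ {n t} → OstrowskiDigits a n d t → prodV a d n ≡ prodM a d n
  prodV≡prodM {zero}  od = refl
  prodV≡prodM {suc n} od = begin
    prodV a d n ++ (V a d (suc n) ^ʷ d (suc (suc n)))
      ≡⟨ cong (_++ (V a d (suc n) ^ʷ d (suc (suc n)))) (prodV≡prodM (restrict od)) ⟩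
    prodM a d n ++ (V a d (suc n) ^ʷ d (suc (suc n)))
      ≡⟨ sym (commute (conj-^ʷ (prodM-conj-Vsuc (restrict od)) (d (suc (suc n))))) ⟩
    (M a (suc n) ^ʷ d (suc (suc n))) ++ prodM a d n ∎
    where open ≡-Reasoning

  module _ (pq : PartialQuotients a) where

    mutual
      ostSum<q : ∀ {n t} → OstrowskiDigits a n d t → ostSum a d n < q a (suc n)
      ostSum<q {zero} od = begin-strict
        d 1 * 1     ≡⟨ *-identityʳ (d 1) ⟩
        d 1         ≤⟨ digit₁ ⟩
        a 1 ∸ 1     <⟨ ∸-monoʳ-< (s≤s z≤n) (pq 0) ⟩
        a 1         ∎
        where
        open ≤-Reasoning
        open OstrowskiDigits od
      ostSum<q {suc m} od with m≤n⇒m<n∨m≡n (leadingDigit≤ od)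
      ... | inj₁ e<A = begin-strict
        ostSum a d m + e * Q  <⟨ +-monoˡ-< (e * Q) (ostSum<q (restrict od)) ⟩
        Q + e * Q             ≤⟨ *-monoˡ-≤ Q e<A ⟩
        A * Q                 ≤⟨ m≤m+n (A * Q) (q a m) ⟩
        A * Q + q a m         ∎
        where
        open ≤-Reasoning
        e = d (suc (suc m)); A = a (suc (suc m)); Q = q a (suc m)
      ... | inj₂ e≡A = begin-strict
        ostSum a d m + e * Q  <⟨ +-monoˡ-< (e * Q) (leadingDigit≡0⇒ostSum<q (restrict od)
                                                    (leadingDigit≡max⇒nextDigit≡0 od e≡A)) ⟩
        q a m + e * Q         ≡⟨ cong (λ x → q a m + x * Q) e≡A ⟩
        q a m + A * Q         ≡⟨ +-comm (q a m) (A * Q) ⟩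
        A * Q + q a m         ∎
        where
        open ≤-Reasoning
        e = d (suc (suc m)); A = a (suc (suc m)); Q = q a (suc m)

      leadingDigit≡0⇒ostSum<q : ∀ {n t} → OstrowskiDigits a n d t → d (suc n) ≡ 0 → ostSum a d n < q a n
      leadingDigit≡0⇒ostSum<q {zero}  od d₁≡0 rewrite d₁≡0 = s≤s z≤n
      leadingDigit≡0⇒ostSum<q {suc r} od dᵣ₊₂≡0 rewrite dᵣ₊₂≡0 | +-identityʳ (ostSum a d r) = ostSum<q (restrict od)

    mutual
      take-ostSum-M≡prodM : ∀ {n t} → OstrowskiDigits a n d t → take (ostSum a d n) (M a (suc n)) ≡ prodM a d n
      take-ostSum-M≡prodM {zero} od = begin
        take (d 1 * 1) (replicate (a 1 ∸ 1) false ++ (true ∷ []))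
          ≡⟨ cong (λ m → take m (replicate (a 1 ∸ 1) false ++ (true ∷ []))) (*-identityʳ (d 1)) ⟩
        take (d 1) (replicate (a 1 ∸ 1) false ++ (true ∷ []))
          ≡⟨ take-++ˡ (replicate (a 1 ∸ 1) false) (true ∷ [])
               (≤-trans digit₁ (≤-reflexive (sym (length-replicate (a 1 ∸ 1))))) ⟩
        take (d 1) (replicate (a 1 ∸ 1) false)
          ≡⟨ take-replicate false digit₁ ⟩
        replicate (d 1) false
          ≡⟨ sym ([x]^ʷ≡replicate false (d 1)) ⟩
        (false ∷ []) ^ʷ d 1 ∎
        where
        open ≡-Reasoning
        open OstrowskiDigits od
      take-ostSum-M≡prodM {suc m} od = begin
        take (s + e * Q) ((M₁ ^ʷ A) ++ M a m)
          ≡⟨ cong₂ take (cong (λ x → s + e * x) (sym (length-M pq (suc m))))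
                        (trans (cong (_++ M a m) (^ʷ-split M₁ e≤A)) (++-assoc (M₁ ^ʷ e) _ (M a m))) ⟩
        take (s + e * length M₁) ((M₁ ^ʷ e) ++ ((M₁ ^ʷ (A ∸ e)) ++ M a m))
          ≡⟨ take-^ʷ-++ M₁ _ e s ⟩
        (M₁ ^ʷ e) ++ take s ((M₁ ^ʷ (A ∸ e)) ++ M a m)
          ≡⟨ cong ((M₁ ^ʷ e) ++_) (take-tail (m≤n⇒m<n∨m≡n e≤A)) ⟩
        (M₁ ^ʷ e) ++ prodM a d m ∎
        where
        open ≡-Reasoning
        e = d (suc (suc m)); A = a (suc (suc m)); Q = q a (suc m)
        M₁ = M a (suc m)
        s = ostSum a d m
        e≤A = leadingDigit≤ od
        take-tail : e < A ⊎ e ≡ A → take s ((M₁ ^ʷ (A ∸ e)) ++ M a m) ≡ prodM a d m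
        -- (1 + A) ∸ suc e is A ∸ e by computation, so +-∸-assoc peels one M₁ off the power.
        take-tail (inj₁ e<A) = begin
          take s ((M₁ ^ʷ (A ∸ e)) ++ M a m)
            ≡⟨ cong (λ k → take s ((M₁ ^ʷ k) ++ M a m)) (+-∸-assoc 1 e<A) ⟩
          take s ((M₁ ++ (M₁ ^ʷ (A ∸ suc e))) ++ M a m)
            ≡⟨ cong (take s) (++-assoc M₁ _ (M a m)) ⟩
          take s (M₁ ++ ((M₁ ^ʷ (A ∸ suc e)) ++ M a m))
            ≡⟨ take-++ˡ M₁ _ (≤-trans (<⇒≤ (ostSum<q (restrict od))) (≤-reflexive (sym (length-M pq (suc m))))) ⟩
          take s M₁
            ≡⟨ take-ostSum-M≡prodM (restrict od) ⟩
          prodM a d m ∎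
        take-tail (inj₂ e≡A) = begin
          take s ((M₁ ^ʷ (A ∸ e)) ++ M a m)
            ≡⟨ cong (λ k → take s ((M₁ ^ʷ k) ++ M a m)) (m≤n⇒m∸n≡0 (≤-reflexive (sym e≡A))) ⟩
          take s (M a m)
            ≡⟨ leadingDigit≡0⇒take-ostSum-M≡prodM (restrict od) (leadingDigit≡max⇒nextDigit≡0 od e≡A) ⟩
          prodM a d m ∎

      leadingDigit≡0⇒take-ostSum-M≡prodM : ∀ {n t} → OstrowskiDigits a n d t → d (suc n) ≡ 0 →
                                           take (ostSum a d n) (M a n) ≡ prodM a d n
      leadingDigit≡0⇒take-ostSum-M≡prodM {zero}  od d₁≡0 rewrite d₁≡0 = refl
      leadingDigit≡0⇒take-ostSum-M≡prodM {suc r} od dᵣ₊₂≡0 rewrite dᵣ₊₂≡0 | +-identityʳ (ostSum a d r) =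
        take-ostSum-M≡prodM (restrict od)

corollary3p5 : (a : ℕ → ℕ) → PartialQuotients a →
    (n t : ℕ) → t < q a (suc n) →
    (d : ℕ → ℕ) → OstrowskiDigits a n d t →
    (take t (M a (suc n)) ≡ prodM a d n) × (take t (M a (suc n)) ≡ prodV a d n)
corollary3p5 a pq n t _ d od = prefix≡prodM , trans prefix≡prodM (sym (prodV≡prodM od))
  where
  prefix≡prodM : take t (M a (suc n)) ≡ prodM a d n
  prefix≡prodM = subst (λ s → take s (M a (suc n)) ≡ prodM a d n) (OstrowskiDigits.value od)
                       (take-ostSum-M≡prodM pq od)
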